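{- Let $G$ and $H$ be connected graphs, each with at least two vertices. Then $pc(G\circ H)\leq \max\{pc(G),pc(H)\}$.
   Context: In an edge-colored graph (adjacent edges may receive the same color), a path is a proper path if no two adjacent edges of the path have the same color. The proper connection number $pc(G)$ of a connected graph $G$ is the minimum number of colors in an edge-coloring of $G$ such that every two distinct vertices are joined by a proper path. The lexicographic product $G\circ H$ has vertex set $V(G)\times V(H)$, with $(g,h)$ adjacent to $(g',h')$ iff $gg'\in E(G)$, or $g=g'$ and $hh'\in E(H)$. -}

module Defs where

open import Level using (0ℓ)
open import Data.Nat using (ℕ; _≤_; _⊔_)
open import Data.Fin using (Fin)
open import Data.Fin.Properties using (*↔×)
open import Data.Product using (Σ; ∃; _×_; _,_; proj₁; proj₂)
open import Data.Sum using (_⊎_; inj₁; inj₂)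
open import Data.Empty using (⊥)
open import Data.Unit using (⊤)
open import Data.List using (List; []; _∷_; _++_)
open import Data.List.Relation.Unary.Unique.Propositional using (Unique)
open import Function.Bundles using (_↔_)
open import Function.Construct.Symmetry using (↔-sym)
open import Relation.Nullary using (¬_)
open import Relation.Binary.PropositionalEquality using (_≡_; _≢_; refl; sym)

record Graph : Set₁ where
  field
    V       : Set
    size    : ℕ
    finite  : V ↔ Fin size
    Adj     : V → V → Set
    sym-adj : ∀ {u v} → Adj u v → Adj v u
    irrefl  : ∀ {u} → ¬ Adj u u
open Graph public

module _ (G : Graph) where
  Chain : List (V G) → Set
  Chain []           = ⊤
  Chain (x ∷ [])     = ⊤
  Chain (x ∷ y ∷ r)  = Adj G x y × Chain (y ∷ r)

  PathVerts : V G → V G → List (V G) → List (V G)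
  PathVerts u v mid = u ∷ (mid ++ (v ∷ []))

  IsPath : V G → V G → List (V G) → Set
  IsPath u v mid = Unique (PathVerts u v mid) × Chain (PathVerts u v mid)

  Connected : Set
  Connected = ∀ (u v : V G) → u ≢ v → ∃ λ mid → IsPath u v mid

  AtLeastTwoVertices : Set
  AtLeastTwoVertices = Σ (V G) λ u → Σ (V G) λ v → u ≢ v

  -- an edge-colouring with (at most) k colours: a colour for each
  -- (ordered) adjacent pair, agreeing on both orientations of an edge
  record EdgeColouring (k : ℕ) : Set where
    field
      col     : ∀ {u v} → Adj G u v → Fin k
      col-sym : ∀ {u v} (e : Adj G u v) → col e ≡ col (sym-adj G e)
  open EdgeColouring public

  ProperAlong : ∀ {k} → EdgeColouring k → (xs : List (V G)) → Chain xs → Set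
  ProperAlong c (x ∷ y ∷ z ∷ r) (e₁ , e₂ , es) =
    col c e₁ ≢ col c e₂ × ProperAlong c (y ∷ z ∷ r) (e₂ , es)
  ProperAlong c _ _ = ⊤

  ProperPath : ∀ {k} → EdgeColouring k → V G → V G → Set
  ProperPath c u v = Σ (List (V G)) λ mid →
    Σ (IsPath u v mid) λ p → ProperAlong c (PathVerts u v mid) (proj₂ p)

  ProperConnecting : ∀ {k} → EdgeColouring k → Set
  ProperConnecting c = ∀ (u v : V G) → u ≢ v → ProperPath c u v

  PCColourable : ℕ → Set
  PCColourable k = Σ (EdgeColouring k) ProperConnecting

  IsPC : ℕ → Set
  IsPC k = PCColourable k × (∀ j → PCColourable j → k ≤ j)

data LexAdj (G H : Graph) : V G × V H → V G × V H → Set where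
  outer : ∀ {g g' h h'} → Adj G g g' → LexAdj G H (g , h) (g' , h')
  inner : ∀ {g h h'} → Adj H h h' → LexAdj G H (g , h) (g , h')

lex-sym : ∀ {G H} {x y} → LexAdj G H x y → LexAdj G H y x
lex-sym {G} (outer e) = outer (sym-adj G e)
lex-sym {G} {H} (inner e) = inner (sym-adj H e)

lex-irrefl : ∀ {G H} {x} → ¬ LexAdj G H x x
lex-irrefl {G} (outer e) = irrefl G e
lex-irrefl {G} {H} (inner e) = irrefl H e

open import Function.Construct.Composition using (_↔-∘_)
open import Data.Product.Function.NonDependent.Propositional using (_×-↔_)

_∘ₗ_ : Graph → Graph → Graph
G ∘ₗ H = record
  { V       = V G × V H
  ; size    = size G Data.Nat.* size H
  ; finite  = ↔-sym *↔× ↔-∘ (finite G ×-↔ finite H)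
  ; Adj     = LexAdj G H
  ; sym-adj = lex-sym
  ; irrefl  = lex-irrefl
  }

-- Colour an outer edge of G ∘ H by its colour in G and an inner edge by its
-- colour in H, both read in Fin (p ⊔ q).  Two vertices in different G-fibres
-- are joined by lifting a proper G-path, keeping the H-coordinate of the start
-- until the very last step (an outer edge may end anywhere in its target
-- fibre); two vertices in the same fibre are joined inside that copy of H.
module Submission where

open import Defs
open import Data.Nat using (ℕ; _≤_; _⊔_)
open import Data.Nat.Properties using (m≤m⊔n; m≤n⊔m)
open import Data.Fin using (Fin; inject≤)
open import Data.Fin.Properties using (inject≤-injective; inj⇒≟)
open import Data.Product using (_,_; proj₁; proj₂)
open import Data.Unit using (tt)
open import Data.List using (List; []; _∷_; map)
open import Data.List.Relation.Unary.Unique.Propositional using (Unique)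
open import Data.List.Relation.Unary.Unique.Propositional.Properties using (map⁻)
open import Function using (_∘_)
open import Function.Definitions using (Injective)
open import Function.Properties.Inverse using (↔⇒↣)
open import Relation.Binary.Definitions using (DecidableEquality)
open import Relation.Nullary using (yes; no)
open import Relation.Binary.PropositionalEquality
  using (_≡_; _≢_; refl; sym; cong; cong₂; subst)

vertex-≟ : (G : Graph) → DecidableEquality (V G)
vertex-≟ G = inj⇒≟ (↔⇒↣ (finite G))

-- The lift of a path u, mid…, v is  f u, map f mid…, f′ v : only the final
-- vertex goes through f′.  The retraction π keeps the lifted vertices distinct.
record PathLift {A B : Graph} {a b : ℕ}
                (cA : EdgeColouring A a) (cB : EdgeColouring B b) : Set where
  field
    f f′        : V A → V B
    π           : V B → V A
    π∘f         : ∀ x → π (f x) ≡ x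
    π∘f′        : ∀ x → π (f′ x) ≡ x
    edge        : ∀ {x y} → Adj A x y → Adj B (f x) (f y)
    edge′       : ∀ {x y} → Adj A x y → Adj B (f x) (f′ y)
    ι           : Fin a → Fin b
    ι-injective : Injective _≡_ _≡_ ι
    col-edge    : ∀ {x y} (e : Adj A x y) → col cB (edge e) ≡ ι (col cA e)
    col-edge′   : ∀ {x y} (e : Adj A x y) → col cB (edge′ e) ≡ ι (col cA e)

  liftVerts : V A → V A → List (V A) → List (V B)
  liftVerts u v mid = PathVerts B (f u) (f′ v) (map f mid)

  π-liftVerts : ∀ u v mid → map π (liftVerts u v mid) ≡ PathVerts A u v mid
  π-liftVerts u v []        = cong₂ (λ x y → x ∷ y ∷ []) (π∘f u) (π∘f′ v)
  π-liftVerts u v (x ∷ mid) = cong₂ _∷_ (π∘f u) (π-liftVerts x v mid)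

  lift-chain : ∀ u v mid → Chain A (PathVerts A u v mid) → Chain B (liftVerts u v mid)
  lift-chain u v []        (e , tt) = edge′ e , tt
  lift-chain u v (x ∷ mid) (e , ch) = edge e , lift-chain x v mid ch

  lift-≢ : ∀ {c₁ c₂ : Fin a} {d₁ d₂ : Fin b} → c₁ ≢ c₂ →
           d₁ ≡ ι c₁ → d₂ ≡ ι c₂ → d₁ ≢ d₂
  lift-≢ c₁≢c₂ refl refl d₁≡d₂ = c₁≢c₂ (ι-injective d₁≡d₂)

  lift-proper : ∀ u v mid (ch : Chain A (PathVerts A u v mid)) →
                ProperAlong A cA (PathVerts A u v mid) ch →
                ProperAlong B cB (liftVerts u v mid) (lift-chain u v mid ch)
  lift-proper u v []            _              _          = tt
  lift-proper u v (x ∷ [])      (e₁ , e₂ , tt) (≢ , tt)   =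
    lift-≢ ≢ (col-edge e₁) (col-edge′ e₂) , tt
  lift-proper u v (x ∷ y ∷ mid) (e₁ , e₂ , ch) (≢ , pr)   =
    lift-≢ ≢ (col-edge e₁) (col-edge e₂) , lift-proper x v (y ∷ mid) (e₂ , ch) pr

  lift-properPath : ∀ {u v} → ProperPath A cA u v → ProperPath B cB (f u) (f′ v)
  lift-properPath {u} {v} (mid , (unique , ch) , pr) =
    map f mid ,
    (map⁻ (subst Unique (sym (π-liftVerts u v mid)) unique) , lift-chain u v mid ch) ,
    lift-proper u v mid ch pr

module LexColouring {G H : Graph} {p q : ℕ}
                    (cG : EdgeColouring G p) (cH : EdgeColouring H q) where

  ιG : Fin p → Fin (p ⊔ q)
  ιG c = inject≤ c (m≤m⊔n p q)

  ιH : Fin q → Fin (p ⊔ q)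
  ιH c = inject≤ c (m≤n⊔m p q)

  lexCol : ∀ {x y} → LexAdj G H x y → Fin (p ⊔ q)
  lexCol (outer e) = ιG (col cG e)
  lexCol (inner e) = ιH (col cH e)

  lexCol-sym : ∀ {x y} (e : LexAdj G H x y) → lexCol e ≡ lexCol (lex-sym e)
  lexCol-sym (outer e) = cong ιG (col-sym cG e)
  lexCol-sym (inner e) = cong ιH (col-sym cH e)

  lexColouring : EdgeColouring (G ∘ₗ H) (p ⊔ q)
  lexColouring = record { col = lexCol ; col-sym = lexCol-sym }

  outerLift : V H → V H → PathLift cG lexColouring
  outerLift h h′ = record
    { f = _, h ; f′ = _, h′ ; π = proj₁ ; π∘f = λ _ → refl ; π∘f′ = λ _ → refl
    ; edge = outer ; edge′ = outer
    ; ι = ιG ; ι-injective = inject≤-injective _ _ _ _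
    ; col-edge = λ _ → refl ; col-edge′ = λ _ → refl
    }

  innerLift : V G → PathLift cH lexColouring
  innerLift g = record
    { f = g ,_ ; f′ = g ,_ ; π = proj₂ ; π∘f = λ _ → refl ; π∘f′ = λ _ → refl
    ; edge = inner ; edge′ = inner
    ; ι = ιH ; ι-injective = inject≤-injective _ _ _ _
    ; col-edge = λ _ → refl ; col-edge′ = λ _ → refl
    }

  lex-properConnecting : ProperConnecting G cG → ProperConnecting H cH →
                         ProperConnecting (G ∘ₗ H) lexColouring
  lex-properConnecting pcG pcH (g , h) (g′ , h′) x≢y with vertex-≟ G g g′
  ... | no g≢g′  = PathLift.lift-properPath (outerLift h h′) (pcG g g′ g≢g′)
  ... | yes refl = PathLift.lift-properPath (innerLift g) (pcH h h′ (x≢y ∘ cong (g ,_)))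

lex-pcColourable : ∀ {G H p q} → PCColourable G p → PCColourable H q →
                   PCColourable (G ∘ₗ H) (p ⊔ q)
lex-pcColourable (cG , pcG) (cH , pcH) =
  lexColouring , lex-properConnecting pcG pcH
  where open LexColouring cG cH

-- Connectivity and the vertex bounds are unused: the bound follows from the
-- minimality of r alone.
corollary1 : (G H : Graph) → Connected G → Connected H → AtLeastTwoVertices G → AtLeastTwoVertices H → (p q : ℕ) → IsPC G p → IsPC H q → (r : ℕ) → IsPC (G ∘ₗ H) r → r ≤ p ⊔ q
corollary1 G H _ _ _ _ p q (colourableG , _) (colourableH , _) r (_ , r-minimal) =
  r-minimal (p ⊔ q) (lex-pcColourable colourableG colourableH)
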